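{- Consider the time-invariant incremental knapsack problem. For an instance, let $\mathrm{LP}$ denote the optimal value of the linear program $$\max \sum_{t=1}^T\sum_{i=1}^N v_i x_{i,t}$$ subject to $\sum_{i=1}^N w_i x_{i,t}\le B_t$ for all $t$; $x_{i,t-1}\le x_{i,t}$ for all $i$ and $t=2,\dots,T$; $x_{i,t}=0$ for every pair $(i,t)$ with $w_i>B_t$; and $x_{i,t}\in[0,1]$ for all $i,t$. Let $\mathrm{IP}$ denote the optimal value of the same program with $x_{i,t}\in\{0,1\}$ for all $i,t$ (i.e., the optimum of the instance). Then the integrality gap $\sup \mathrm{LP}/\mathrm{IP}$ over all instances is not bounded by any constant.
   Context: The time-invariant incremental knapsack problem: there are $T$ periods with capacities $B_1\le\dots\le B_T$, and $N$ items, item $i$ having value $v_i>0$ and weight $w_i>0$. A feasible solution is $x\in\{0,1\}^{N\times T}$, where $x_{i,t}=1$ means item $i$ is in the knapsack in period $t$, such that $x_{i,t-1}\le x_{i,t}$ (items are never removed) and $\sum_i w_i x_{i,t}\le B_t$ for all $t$. The objective is to maximize $\sum_{t=1}^T\sum_{i=1}^N v_i x_{i,t}$. -}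

module Defs where

open import Data.Nat using (ℕ; zero; suc)
open import Data.Fin using (Fin; toℕ) renaming (zero to fzero; suc to fsuc)
open import Data.Rational using (ℚ; 0ℚ; 1ℚ; _+_; _*_; _≤_; _<_)
open import Data.Product using (_×_)
open import Data.Sum using (_⊎_)
open import Relation.Binary.PropositionalEquality using (_≡_)

sumFin : (n : ℕ) → (Fin n → ℚ) → ℚ
sumFin zero    f = 0ℚ
sumFin (suc n) f = f fzero + sumFin n (λ i → f (fsuc i))

record Instance : Set where
  field
    N T  : ℕ
    v w  : Fin N → ℚ
    B    : Fin T → ℚ
    v-pos : ∀ i → 0ℚ < v i
    w-pos : ∀ i → 0ℚ < w i
    B-mono : ∀ (s t : Fin T) → suc (toℕ s) ≡ toℕ t → B s ≤ B t
open Instance public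

Assignment : Instance → Set
Assignment I = Fin (N I) → Fin (T I) → ℚ

objective : (I : Instance) → Assignment I → ℚ
objective I x = sumFin (T I) (λ t → sumFin (N I) (λ i → v I i * x i t))

LPFeasible : (I : Instance) → Assignment I → Set
LPFeasible I x =
    (∀ t → sumFin (N I) (λ i → w I i * x i t) ≤ B I t)
  × (∀ i (s t : Fin (T I)) → suc (toℕ s) ≡ toℕ t → x i s ≤ x i t)
  × (∀ i t → B I t < w I i → x i t ≡ 0ℚ)
  × (∀ i t → 0ℚ ≤ x i t × x i t ≤ 1ℚ)

IPFeasible : (I : Instance) → Assignment I → Set
IPFeasible I x = LPFeasible I x × (∀ i t → x i t ≡ 0ℚ ⊎ x i t ≡ 1ℚ)

-- For n ≥ 2 items put a = n², and let item i (0 ≤ i < n) have weight and value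
-- a^i.  Periods form a staircase: level k consists of a^(n-1-k) consecutive
-- periods of capacity a^k, levels increasing over time, so every level carries
-- total capacity a^(n-1) and the total capacity is n·a^(n-1).
--
-- * LP side.  x_{i,t} = ½·[i ≤ level t] is feasible because the geometric
--   series a^0 + … + a^k stays below 2a^k; its value is at least half the total
--   capacity, ½·n·a^(n-1).
-- * IP side.  If the item matching the level of period t is not packed, all
--   packed items of t are lighter, so a·load ≤ n·a^(level t).  If it is packed,
--   nothing else fits, and since packed items stay packed this can happen on a
--   single level only, contributing at most a^n in total.  Summing,
--   a·IP ≤ n·n·a^(n-1) + a^n, i.e. IP ≤ 2·a^(n-1).
--
-- Hence LP/IP ≥ n/4, and n = 4c + 2 beats any bound c.
module Submission where

open import Defs

module OverNat where
  open import Data.Nat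
  open import Data.Nat.Properties
  open import Data.Fin using (Fin; zero; suc; toℕ)
  open import Data.Fin.Properties using (toℕ-injective; any?)
    renaming (_≟_ to _≟ᶠ_; suc-injective to fsuc-injective)
  open import Data.Product using (Σ; _,_)
  open import Data.Sum using (_⊎_; inj₁; inj₂)
  open import Data.Empty using (⊥; ⊥-elim)
  open import Function using (_∘_)
  open import Relation.Nullary using (yes; no; contradiction)
  open import Relation.Binary.Definitions using (tri<; tri≈; tri>)
  open import Relation.Binary.PropositionalEquality
  open import Algebra.Properties.Semiring.Sum +-*-semiring
    using (sum; sum-cong-≗; sum-replicate-zero; *-distribˡ-sum; ∑-distrib-+)
  open import Algebra.Properties.CommutativeSemigroup *-commutativeSemigroup
    using (x∙yz≈y∙xz)

  sum-mono : ∀ {n} {f g : Fin n → ℕ} → (∀ i → f i ≤ g i) → sum f ≤ sum g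
  sum-mono {zero}  _   = z≤n
  sum-mono {suc n} f≤g = +-mono-≤ (f≤g zero) (sum-mono (f≤g ∘ suc))

  sum-const : ∀ n x → sum {n} (λ _ → x) ≡ n * x
  sum-const zero    x = refl
  sum-const (suc n) x = cong (x +_) (sum-const n x)

  sum-≥-term : ∀ {n} (f : Fin n → ℕ) j → f j ≤ sum f
  sum-≥-term f zero    = m≤m+n (f zero) _
  sum-≥-term f (suc j) = ≤-trans (sum-≥-term (f ∘ suc) j) (m≤n+m _ (f zero))

  sum-≥-pair : ∀ {n} (f : Fin n → ℕ) {j k} → j ≢ k → f j + f k ≤ sum f
  sum-≥-pair f {zero}  {zero}  j≢k = contradiction refl j≢k
  sum-≥-pair f {zero}  {suc k} _   = +-monoʳ-≤ (f zero) (sum-≥-term (f ∘ suc) k)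
  sum-≥-pair f {suc j} {zero}  _   =
    subst (_≤ sum f) (+-comm (f zero) (f (suc j))) (+-monoʳ-≤ (f zero) (sum-≥-term (f ∘ suc) j))
  sum-≥-pair f {suc j} {suc k} j≢k =
    ≤-trans (sum-≥-pair (f ∘ suc) (j≢k ∘ cong suc)) (m≤n+m _ (f zero))

  sum-single-support : ∀ {n} (f : Fin n → ℕ) j → (∀ k → k ≢ j → f k ≡ 0) → sum f ≡ f j
  sum-single-support {suc n} f zero vanish =
    trans (cong (f zero +_) (trans (sum-cong-≗ (λ k → vanish (suc k) λ ())) (sum-replicate-zero n)))
          (+-identityʳ (f zero))
  sum-single-support f (suc j) vanish =
    trans (cong (_+ sum (f ∘ suc)) (vanish zero λ ()))
          (sum-single-support (f ∘ suc) j (λ k k≢j → vanish (suc k) (k≢j ∘ fsuc-injective)))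

  -- A sequence that increases between consecutive indices is monotone.  The LP
  -- constraints only speak about consecutive periods.
  consecutive⇒monotone : ∀ {T} (f : Fin T → ℕ) → (∀ s t → suc (toℕ s) ≡ toℕ t → f s ≤ f t) →
                         ∀ {s t} → toℕ s ≤ toℕ t → f s ≤ f t
  consecutive⇒monotone f step {zero}  {zero}        _ = ≤-refl
  consecutive⇒monotone f step {zero}  {suc zero}    _ = step zero (suc zero) refl
  consecutive⇒monotone f step {zero}  {suc (suc t)} _ =
    ≤-trans (step zero (suc zero) refl)
            (consecutive⇒monotone (f ∘ suc) (λ s t e → step (suc s) (suc t) (cong suc e)) {zero} {suc t} z≤n)
  consecutive⇒monotone f step {suc s} {suc t} (s≤s s≤t) =
    consecutive⇒monotone (f ∘ suc) (λ s t e → step (suc s) (suc t) (cong suc e)) s≤t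

  -- Staircase schedules: a map from periods to levels, non-decreasing in time.

  Monotone : ∀ {k n} → (Fin k → Fin n) → Set
  Monotone g = ∀ {s t} → toℕ s ≤ toℕ t → toℕ (g s) ≤ toℕ (g t)

  prepend : ∀ m {k n} → (Fin k → Fin n) → Fin (m + k) → Fin (suc n)
  prepend zero    g t       = suc (g t)
  prepend (suc m) g zero    = zero
  prepend (suc m) g (suc t) = prepend m g t

  prepend-mono : ∀ m {k n} (g : Fin k → Fin n) → Monotone g → Monotone (prepend m g)
  prepend-mono zero    g g-mono s≤t             = s≤s (g-mono s≤t)
  prepend-mono (suc m) g g-mono {zero}  {_}     _         = z≤n
  prepend-mono (suc m) g g-mono {suc s} {suc t} (s≤s s≤t) = prepend-mono m g g-mono s≤t

  sum-prepend : ∀ m {k n} (g : Fin k → Fin n) (f : Fin (suc n) → ℕ) →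
                sum (f ∘ prepend m g) ≡ m * f zero + sum (f ∘ suc ∘ g)
  sum-prepend zero    g f = refl
  sum-prepend (suc m) g f =
    trans (cong (f zero +_) (sum-prepend m g f)) (sym (+-assoc (f zero) (m * f zero) _))

  stairs : ∀ n (c : Fin n → ℕ) → Fin (sum c) → Fin n
  stairs (suc n) c = prepend (c zero) (stairs n (c ∘ suc))

  stairs-mono : ∀ n (c : Fin n → ℕ) → Monotone (stairs n c)
  stairs-mono (suc n) c = prepend-mono (c zero) (stairs n (c ∘ suc)) (stairs-mono n (c ∘ suc))

  sum-stairs : ∀ n (c : Fin n → ℕ) (f : Fin n → ℕ) → sum (f ∘ stairs n c) ≡ sum (λ k → c k * f k)
  sum-stairs zero    c f = refl
  sum-stairs (suc n) c f =
    trans (sum-prepend (c zero) (stairs n (c ∘ suc)) f)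
          (cong (c zero * f zero +_) (sum-stairs n (c ∘ suc) (f ∘ suc)))

  -- below i k is the indicator of i ≤ k.
  below : ℕ → ℕ → ℕ
  below zero    k       = 1
  below (suc i) zero    = 0
  below (suc i) (suc k) = below i k

  below-≤1 : ∀ i k → below i k ≤ 1
  below-≤1 zero    k       = ≤-refl
  below-≤1 (suc i) zero    = z≤n
  below-≤1 (suc i) (suc k) = below-≤1 i k

  below-refl : ∀ k → below k k ≡ 1
  below-refl zero    = refl
  below-refl (suc k) = below-refl k

  below-zero : ∀ {i k} → k < i → below i k ≡ 0
  below-zero {suc i} {zero}  _         = refl
  below-zero {suc i} {suc k} (s≤s k<i) = below-zero k<i

  below-mono : ∀ i {k l} → k ≤ l → below i k ≤ below i l
  below-mono zero    _         = ≤-refl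
  below-mono (suc i) {zero}  _ = z≤n
  below-mono (suc i) {suc k} {suc l} (s≤s k≤l) = below-mono i k≤l

  -- Geometric series: for a ≥ 2 the weights a^0, …, a^k add up to less than 2·a^k.
  -- This is what makes the half-filled LP solution fit.
  geometric : ∀ a → 2 ≤ a → ∀ n k → sum {n} (λ i → below (toℕ i) k * a ^ toℕ i) < 2 * a ^ k
  geometric a 2≤a zero    k    = ≤-trans (m^n>0 a {{>-nonZero (≤-trans (s≤s z≤n) 2≤a)}} k) (m≤m+n (a ^ k) _)
  geometric a 2≤a (suc n) zero = s≤s (s≤s (≤-reflexive (sum-replicate-zero n)))
  geometric a 2≤a (suc n) (suc k) = begin-strict
      1 + G′             ≡⟨ cong suc G′≡aG ⟩
      1 + a * G          <⟨ +-monoˡ-≤ (a * G) 2≤a ⟩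
      a + a * G          ≡⟨ sym (*-suc a G) ⟩
      a * suc G          ≤⟨ *-monoʳ-≤ a (geometric a 2≤a n k) ⟩
      a * (2 * a ^ k)    ≡⟨ x∙yz≈y∙xz a 2 (a ^ k) ⟩
      2 * (a * a ^ k)    ∎
    where
    open ≤-Reasoning
    G G′ : ℕ
    G  = sum {n} (λ i → below (toℕ i) k * a ^ toℕ i)
    G′ = sum {n} (λ i → below (toℕ i) k * (a * a ^ toℕ i))
    G′≡aG : G′ ≡ a * G
    G′≡aG = trans (sum-cong-≗ {n} {x = λ i → below (toℕ i) k * (a * a ^ toℕ i)}
                              (λ i → x∙yz≈y∙xz (below (toℕ i) k) a (a ^ toℕ i)))
                  (sym (*-distribˡ-sum {n} a (λ i → below (toℕ i) k * a ^ toℕ i)))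

  -- The staircase used in the construction, for a base a ≥ 1: level k among n
  -- levels has capacity a^k and consists of a^(n-1-k) periods.
  module Levels (a : ℕ) .{{_ : NonZero a}} where

    count : ∀ n → Fin n → ℕ
    count (suc n) zero    = a ^ n
    count (suc n) (suc k) = count n k

    count-weight : ∀ m k → count (suc m) k * a ^ toℕ k ≡ a ^ m
    count-weight m       zero    = *-identityʳ (a ^ m)
    count-weight (suc m) (suc k) =
      trans (x∙yz≈y∙xz (count (suc m) k) a (a ^ toℕ k)) (cong (a *_) (count-weight m k))

    Periods : ℕ → ℕ
    Periods n = sum (count n)

    level : ∀ n → Fin (Periods n) → Fin n
    level n = stairs n (count n)

    total-capacity : ∀ m → sum (λ t → a ^ toℕ (level (suc m) t)) ≡ suc m * a ^ m
    total-capacity m =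
      trans (sum-stairs (suc m) (count (suc m)) (λ k → a ^ toℕ k))
            (trans (sum-cong-≗ (count-weight m)) (sum-const (suc m) (a ^ m)))

    bonus : ∀ {n} → Fin n → Fin n → ℕ
    bonus k₀ k with k ≟ᶠ k₀
    ... | yes _ = a ^ suc (toℕ k)
    ... | no  _ = 0

    bonus-total : ∀ m (k₀ : Fin (suc m)) → sum (λ k → count (suc m) k * bonus k₀ k) ≡ a ^ suc m
    bonus-total m k₀ = trans (sum-single-support _ k₀ off-k₀) at-k₀
      where
      off-k₀ : ∀ k → k ≢ k₀ → count (suc m) k * bonus k₀ k ≡ 0
      off-k₀ k k≢k₀ with k ≟ᶠ k₀
      ... | yes k≡k₀ = contradiction k≡k₀ k≢k₀
      ... | no  _    = *-zeroʳ (count (suc m) k)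
      at-k₀ : count (suc m) k₀ * bonus k₀ k₀ ≡ a ^ suc m
      at-k₀ with k₀ ≟ᶠ k₀
      ... | yes _    = trans (x∙yz≈y∙xz (count (suc m) k₀) a (a ^ toℕ k₀)) (cong (a *_) (count-weight m k₀))
      ... | no k₀≢k₀ = contradiction refl k₀≢k₀

    module Packing (m : ℕ) (β : Fin (suc m) → Fin (Periods (suc m)) → ℕ)
      (binary : ∀ i t → β i t ≡ 0 ⊎ β i t ≡ 1)
      (fits : ∀ t → sum (λ i → β i t * a ^ toℕ i) ≤ a ^ toℕ (level (suc m) t))
      (too-heavy : ∀ i t → toℕ (level (suc m) t) < toℕ i → β i t ≡ 0)
      (persistent : ∀ i {s t} → toℕ s ≤ toℕ t → β i s ≤ β i t) where

      n : ℕ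
      n = suc m

      lv : Fin (Periods n) → ℕ
      lv t = toℕ (level n t)

      load : Fin (Periods n) → ℕ
      load t = sum (λ i → β i t * a ^ toℕ i)

      own : Fin (Periods n) → ℕ
      own t = β (level n t) t

      -- The own item of t fills its capacity exactly, so nothing else fits beside it.
      own-excludes : ∀ t j → j ≢ level n t → 0 < β j t → own t ≡ 1 → ⊥
      own-excludes t j j≢own packed own≡1 = <⇒≱ overfull (fits t)
        where
        open ≤-Reasoning
        overfull : a ^ lv t < load t
        overfull = begin-strict
          a ^ lv t                                 ≡⟨ sym (*-identityˡ _) ⟩
          1 * a ^ lv t                             ≡⟨ cong (_* a ^ lv t) (sym own≡1) ⟩
          own t * a ^ lv t                         <⟨ m<n+m _ (*-mono-≤ packed (m^n>0 a (toℕ j))) ⟩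
          β j t * a ^ toℕ j + own t * a ^ lv t     ≤⟨ sum-≥-pair (λ i → β i t * a ^ toℕ i) j≢own ⟩
          load t                                   ∎

      -- A packed own item stays packed, so two periods with packed own items
      -- cannot lie on different levels.
      own-on-lower-level : ∀ s t → lv s < lv t → own s ≡ 1 → own t ≡ 1 → ⊥
      own-on-lower-level s t lt own-s own-t =
        own-excludes t (level n s) (λ e → <⇒≢ lt (cong toℕ e)) still-packed own-t
        where
        s≤t : toℕ s ≤ toℕ t
        s≤t = ≮⇒≥ (λ t<s → <⇒≱ lt (stairs-mono n (count n) (<⇒≤ t<s)))
        still-packed : 0 < β (level n s) t
        still-packed = ≤-trans (≤-reflexive (sym own-s)) (persistent (level n s) s≤t)

      own-level : Σ (Fin n) λ k₀ → ∀ t → own t ≡ 1 → level n t ≡ k₀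
      own-level with any? (λ t → own t ≟ 1)
      ... | yes (t₀ , own₀) = level n t₀ , λ t own-t → same-level t t₀ own-t own₀
        where
        same-level : ∀ s t → own s ≡ 1 → own t ≡ 1 → level n s ≡ level n t
        same-level s t own-s own-t with <-cmp (lv s) (lv t)
        ... | tri< lt _ _ = ⊥-elim (own-on-lower-level s t lt own-s own-t)
        ... | tri≈ _ eq _ = toℕ-injective eq
        ... | tri> _ _ gt = ⊥-elim (own-on-lower-level t s gt own-t own-s)
      ... | no none = zero , λ t own-t → contradiction (t , own-t) none

      own-total : sum (λ t → own t * a ^ suc (lv t)) ≤ a ^ n
      own-total with own-level
      ... | k₀ , on-k₀ = begin
          sum (λ t → own t * a ^ suc (lv t))       ≤⟨ sum-mono own≤bonus ⟩
          sum (λ t → bonus k₀ (level n t))         ≡⟨ sum-stairs n (count n) (bonus k₀) ⟩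
          sum (λ k → count n k * bonus k₀ k)       ≡⟨ bonus-total m k₀ ⟩
          a ^ n                                    ∎
        where
        open ≤-Reasoning
        own≤bonus : ∀ t → own t * a ^ suc (lv t) ≤ bonus k₀ (level n t)
        own≤bonus t with binary (level n t) t
        ... | inj₁ own≡0 = subst (λ b → b * a ^ suc (lv t) ≤ bonus k₀ (level n t)) (sym own≡0) z≤n
        ... | inj₂ own≡1 with level n t ≟ᶠ k₀
        ...   | yes _   = ≤-reflexive (trans (cong (_* a ^ suc (lv t)) own≡1) (*-identityˡ _))
        ...   | no  off = contradiction (on-k₀ t own≡1) off

      -- Without its own item, every packed item of t weighs at most a^(lv t - 1).
      without-own : ∀ t → own t ≡ 0 → a * load t ≤ n * a ^ lv t
      without-own t own≡0 = begin
          a * load t                                 ≡⟨ *-distribˡ-sum a (λ i → β i t * a ^ toℕ i) ⟩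
          sum (λ i → a * (β i t * a ^ toℕ i))        ≡⟨ sum-cong-≗ {x = λ i → a * (β i t * a ^ toℕ i)}
                                                          (λ i → x∙yz≈y∙xz a (β i t) (a ^ toℕ i)) ⟩
          sum (λ i → β i t * a ^ suc (toℕ i))        ≤⟨ sum-mono term-bound ⟩
          sum {n} (λ _ → a ^ lv t)                   ≡⟨ sum-const n _ ⟩
          n * a ^ lv t                               ∎
        where
        open ≤-Reasoning
        term-bound : ∀ i → β i t * a ^ suc (toℕ i) ≤ a ^ lv t
        term-bound i with binary i t
        ... | inj₁ β≡0 = subst (λ b → b * a ^ suc (toℕ i) ≤ a ^ lv t) (sym β≡0) z≤n
        ... | inj₂ β≡1 = subst (λ b → b * a ^ suc (toℕ i) ≤ a ^ lv t) (sym β≡1)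
                           (≤-trans (≤-reflexive (*-identityˡ _)) (^-monoʳ-≤ a i<lv))
          where
          0≢1 : 0 ≢ 1
          0≢1 ()
          i≤lv : toℕ i ≤ lv t
          i≤lv = ≮⇒≥ (λ lv<i → 0≢1 (trans (sym (too-heavy i t lv<i)) β≡1))
          i<lv : toℕ i < lv t
          i<lv = ≤∧≢⇒< i≤lv (λ e → 0≢1 (trans (sym own≡0)
                   (trans (cong (λ j → β j t) (sym (toℕ-injective e))) β≡1)))

      period-bound : ∀ t → a * load t ≤ n * a ^ lv t + own t * a ^ suc (lv t)
      period-bound t with binary (level n t) t
      ... | inj₁ own≡0 = ≤-trans (without-own t own≡0) (m≤m+n _ _)
      ... | inj₂ own≡1 = begin
          a * load t                            ≤⟨ *-monoʳ-≤ a (fits t) ⟩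
          a ^ suc (lv t)                        ≡⟨ sym (*-identityˡ _) ⟩
          1 * a ^ suc (lv t)                    ≡⟨ cong (_* a ^ suc (lv t)) (sym own≡1) ⟩
          own t * a ^ suc (lv t)                ≤⟨ m≤n+m _ _ ⟩
          n * a ^ lv t + own t * a ^ suc (lv t) ∎
        where open ≤-Reasoning

      packing-bound : a * sum load ≤ n * (n * a ^ m) + a * a ^ m
      packing-bound = begin
          a * sum load                                                      ≡⟨ *-distribˡ-sum a load ⟩
          sum (λ t → a * load t)                                            ≤⟨ sum-mono period-bound ⟩
          sum (λ t → n * a ^ lv t + own t * a ^ suc (lv t))                 ≡⟨ ∑-split ⟩
          sum (λ t → n * a ^ lv t) + sum (λ t → own t * a ^ suc (lv t))     ≤⟨ +-mono-≤ capacities own-total ⟩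
          n * (n * a ^ m) + a * a ^ m                                       ∎
        where
        open ≤-Reasoning
        ∑-split : sum (λ t → n * a ^ lv t + own t * a ^ suc (lv t))
                ≡ sum (λ t → n * a ^ lv t) + sum (λ t → own t * a ^ suc (lv t))
        ∑-split = ∑-distrib-+ (λ t → n * a ^ lv t) (λ t → own t * a ^ suc (lv t))
        capacities : sum (λ t → n * a ^ lv t) ≤ n * (n * a ^ m)
        capacities = ≤-reflexive (trans (sym (*-distribˡ-sum n (λ t → a ^ lv t))) (cong (n *_) (total-capacity m)))

-- The rational operators are brought into scope only here, after the ℕ part,
-- since they share their names with those of ℕ.
open import Data.Rational using (ℚ; _*_; _<_)
open import Data.Product using (Σ; _×_; _,_)
open import Data.Sum using (_⊎_; inj₁; inj₂)
open import Data.Nat as ℕ using (ℕ; zero; suc; z≤n; s≤s; _^_)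
import Data.Nat.Properties as ℕP
open import Data.Integer as ℤ using (+_; -[1+_])
import Data.Integer.Properties as ℤP
import Data.Rational as Q
import Data.Rational.Properties as QP
import Data.Nat.Coprimality as Coprime
open import Data.Fin using (Fin; toℕ) renaming (zero to fzero; suc to fsuc)
open import Algebra.Bundles using (CommutativeMonoid)
open import Algebra.Properties.CommutativeSemigroup
  (CommutativeMonoid.commutativeSemigroup QP.*-1-commutativeMonoid)
  using () renaming (x∙yz≈y∙xz to ℚ-x∙yz≈y∙xz)
open import Algebra.Properties.Semiring.Sum ℕP.+-*-semiring using (sum)
open import Relation.Nullary.Decidable using (from-yes)
open import Relation.Binary.PropositionalEquality
open OverNat

ι : ℕ → ℚ
ι n = + n Q./ 1

ι-nf : ∀ n → ι n ≡ Q.mkℚ (+ n) 0 (Coprime.sym (Coprime.1-coprimeTo n))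
ι-nf n = QP.normalize-coprime (Coprime.sym (Coprime.1-coprimeTo n))

ι-+ : ∀ m n → ι (m ℕ.+ n) ≡ ι m Q.+ ι n
ι-+ m n rewrite ι-nf m | ι-nf n =
  cong (Q._/ 1) (sym (cong₂ ℤ._+_ (ℤP.*-identityʳ (+ m)) (ℤP.*-identityʳ (+ n))))

ι-* : ∀ m n → ι (m ℕ.* n) ≡ ι m * ι n
ι-* m n rewrite ι-nf m | ι-nf n = cong (Q._/ 1) (ℤP.pos-* m n)

ι-≤ : ∀ {m n} → m ℕ.≤ n → ι m Q.≤ ι n
ι-≤ {m} {n} m≤n rewrite ι-nf m | ι-nf n =
  Q.*≤* (subst₂ ℤ._≤_ (sym (ℤP.*-identityʳ (+ m))) (sym (ℤP.*-identityʳ (+ n))) (ℤ.+≤+ m≤n))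

ι-≤⁻ : ∀ {m n} → ι m Q.≤ ι n → m ℕ.≤ n
ι-≤⁻ {m} {n} ιm≤ιn rewrite ι-nf m | ι-nf n =
  ℤP.drop‿+≤+ (subst₂ ℤ._≤_ (ℤP.*-identityʳ (+ m)) (ℤP.*-identityʳ (+ n)) (QP.drop-*≤* ιm≤ιn))

ι-< : ∀ {m n} → m ℕ.< n → ι m < ι n
ι-< {m} {n} m<n rewrite ι-nf m | ι-nf n =
  Q.*<* (subst₂ ℤ._<_ (sym (ℤP.*-identityʳ (+ m))) (sym (ℤP.*-identityʳ (+ n))) (ℤ.+<+ m<n))

half-double : ∀ k → Q.½ * ι (2 ℕ.* k) ≡ ι k
half-double k = trans (cong (Q.½ *_) (ι-* 2 k)) (trans (sym (QP.*-assoc Q.½ (ι 2) (ι k))) (QP.*-identityˡ (ι k)))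

natAbove : ℚ → ℕ
natAbove (Q.mkℚ (+ k)    _ _) = k
natAbove (Q.mkℚ -[1+ _ ] _ _) = 0

natAbove-≥ : ∀ C → C Q.≤ ι (natAbove C)
natAbove-≥ (Q.mkℚ (+ k) d _) rewrite ι-nf k =
  Q.*≤* (subst₂ ℤ._≤_ (ℤP.pos-* k 1) (ℤP.pos-* k (suc d)) (ℤ.+≤+ (ℕP.*-monoʳ-≤ k (s≤s z≤n))))
natAbove-≥ (Q.mkℚ -[1+ _ ] _ _) = Q.*≤* ℤ.-≤+

sumFin-cong : ∀ n {f g : Fin n → ℚ} → (∀ i → f i ≡ g i) → sumFin n f ≡ sumFin n g
sumFin-cong zero    _   = refl
sumFin-cong (suc n) f≡g = cong₂ Q._+_ (f≡g fzero) (sumFin-cong n (λ i → f≡g (fsuc i)))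

sumFin-scaled : ∀ n q (f : Fin n → ℕ) → sumFin n (λ i → q * ι (f i)) ≡ q * ι (sum f)
sumFin-scaled zero    q f = sym (QP.*-zeroʳ q)
sumFin-scaled (suc n) q f = begin
  q * ι (f fzero) Q.+ sumFin n (λ i → q * ι (f (fsuc i)))  ≡⟨ cong (q * ι (f fzero) Q.+_) (sumFin-scaled n q (λ i → f (fsuc i))) ⟩
  q * ι (f fzero) Q.+ q * ι (sum (λ i → f (fsuc i)))       ≡⟨ sym (QP.*-distribˡ-+ q _ _) ⟩
  q * (ι (f fzero) Q.+ ι (sum (λ i → f (fsuc i))))         ≡⟨ cong (q *_) (sym (ι-+ (f fzero) _)) ⟩
  q * ι (sum f)                                             ∎
  where open ≡-Reasoning

sumFin-ι : ∀ n (f : Fin n → ℕ) → sumFin n (λ i → ι (f i)) ≡ ι (sum f)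
sumFin-ι n f = trans (sumFin-cong n (λ i → sym (QP.*-identityˡ (ι (f i)))))
                     (trans (sumFin-scaled n Q.1ℚ f) (QP.*-identityˡ (ι (sum f))))

half-bit-bounds : ∀ {b} → b ℕ.≤ 1 → Q.0ℚ Q.≤ Q.½ * ι b × Q.½ * ι b Q.≤ Q.1ℚ
half-bit-bounds {zero}  _ = from-yes (Q.0ℚ QP.≤? Q.½ * ι 0) , from-yes (Q.½ * ι 0 QP.≤? Q.1ℚ)
half-bit-bounds {suc zero} _ = from-yes (Q.0ℚ QP.≤? Q.½ * ι 1) , from-yes (Q.½ * ι 1 QP.≤? Q.1ℚ)
half-bit-bounds {suc (suc _)} (s≤s ())

bit : ∀ {q : ℚ} → q ≡ Q.0ℚ ⊎ q ≡ Q.1ℚ → ℕ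
bit (inj₁ _) = 0
bit (inj₂ _) = 1

bit-ι : ∀ {q} (d : q ≡ Q.0ℚ ⊎ q ≡ Q.1ℚ) → q ≡ ι (bit d)
bit-ι (inj₁ q≡0) = q≡0
bit-ι (inj₂ q≡1) = q≡1

bit-binary : ∀ {q} (d : q ≡ Q.0ℚ ⊎ q ≡ Q.1ℚ) → bit d ≡ 0 ⊎ bit d ≡ 1
bit-binary (inj₁ _) = inj₁ refl
bit-binary (inj₂ _) = inj₂ refl

bit-zero : ∀ {q} (d : q ≡ Q.0ℚ ⊎ q ≡ Q.1ℚ) → q ≡ Q.0ℚ → bit d ≡ 0
bit-zero (inj₁ _)   _   = refl
bit-zero (inj₂ q≡1) q≡0 with () ← trans (sym q≡1) q≡0

-- The final count: with n = 4c + 2, an IP value O ≤ 2P and an LP value ½·G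
-- with G ≥ n·P satisfy c·O < ½·G.
gap-arithmetic : ∀ c {P O G} → 0 ℕ.< P → O ℕ.≤ P ℕ.+ P → (2 ℕ.+ 4 ℕ.* c) ℕ.* P ℕ.≤ G → 2 ℕ.* (c ℕ.* O) ℕ.< G
gap-arithmetic c {P} {O} P>0 O≤2P nP≤G = begin-strict
    2 ℕ.* (c ℕ.* O)          ≤⟨ ℕP.*-monoʳ-≤ 2 (ℕP.*-monoʳ-≤ c O≤2P) ⟩
    2 ℕ.* (c ℕ.* (P ℕ.+ P))  ≡⟨ four-c c P ⟩
    4 ℕ.* c ℕ.* P            <⟨ ℕP.m<n+m _ P>0 ⟩
    P ℕ.+ 4 ℕ.* c ℕ.* P      ≤⟨ ℕP.m≤n+m _ P ⟩
    (2 ℕ.+ 4 ℕ.* c) ℕ.* P    ≤⟨ nP≤G ⟩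
    _                         ∎
  where
  open ℕP.≤-Reasoning
  open import Data.Nat.Tactic.RingSolver using (solve-∀)
  four-c : ∀ c P → 2 ℕ.* (c ℕ.* (P ℕ.+ P)) ≡ 4 ℕ.* c ℕ.* P
  four-c = solve-∀

-- The instance with n = m + 2 items and base a = n², and its LP and IP values.
-- The base is a parameter constrained by an equation, which keeps it symbolic in
-- all types below.
module Gap (m a : ℕ) (a≡n² : a ≡ suc (suc m) ℕ.* suc (suc m)) where
  n P : ℕ
  n = suc (suc m)
  P = a ^ suc m

  2≤a : 2 ℕ.≤ a
  2≤a = subst (2 ℕ.≤_) (sym a≡n²) (s≤s (s≤s z≤n))

  instance
    a-nonZero : ℕ.NonZero a
    a-nonZero = ℕ.>-nonZero (ℕP.≤-trans (s≤s z≤n) 2≤a)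

  open Levels a

  P-positive : 0 ℕ.< P
  P-positive = ℕP.m^n>0 a (suc m)

  lv : Fin (Periods n) → ℕ
  lv t = toℕ (level n t)

  weight : Fin n → ℚ
  weight i = ι (a ^ toℕ i)

  consecutive-≤ : ∀ {s t : Fin (Periods n)} → suc (toℕ s) ≡ toℕ t → toℕ s ℕ.≤ toℕ t
  consecutive-≤ {s} e = subst (toℕ s ℕ.≤_) e (ℕP.n≤1+n (toℕ s))

  inst : Instance
  inst = record
    { N = n ; T = Periods n
    ; v = weight ; w = weight
    ; B = λ t → ι (a ^ lv t)
    ; v-pos = λ i → ι-< (ℕP.m^n>0 a (toℕ i))
    ; w-pos = λ i → ι-< (ℕP.m^n>0 a (toℕ i))
    ; B-mono = λ s t e → ι-≤ (ℕP.^-monoʳ-≤ a (stairs-mono n (count n) (consecutive-≤ e)))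
    }

  xLP : Assignment inst
  xLP i t = Q.½ * ι (below (toℕ i) (lv t))

  lp-term : Fin (Periods n) → Fin n → ℕ
  lp-term t i = below (toℕ i) (lv t) ℕ.* a ^ toℕ i

  lp-load : Fin (Periods n) → ℕ
  lp-load t = sum (lp-term t)

  lp-row : ∀ t → sumFin n (λ i → weight i * xLP i t) ≡ Q.½ * ι (lp-load t)
  lp-row t = trans (sumFin-cong n term) (sumFin-scaled n Q.½ (lp-term t))
    where
    term : ∀ i → weight i * xLP i t ≡ Q.½ * ι (lp-term t i)
    term i = trans (ℚ-x∙yz≈y∙xz (weight i) Q.½ (ι (below (toℕ i) (lv t))))
                   (cong (Q.½ *_) (trans (QP.*-comm (weight i) (ι (below (toℕ i) (lv t))))
                                          (sym (ι-* (below (toℕ i) (lv t)) (a ^ toℕ i)))))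

  lp-feasible : LPFeasible inst xLP
  lp-feasible = capacity , growing , too-heavy , (λ i t → half-bit-bounds (below-≤1 (toℕ i) (lv t)))
    where
    capacity : ∀ t → sumFin n (λ i → weight i * xLP i t) Q.≤ ι (a ^ lv t)
    capacity t = subst₂ Q._≤_ (sym (lp-row t)) (half-double (a ^ lv t))
                   (QP.*-monoˡ-≤-nonNeg Q.½ (ι-≤ (ℕP.<⇒≤ (geometric a 2≤a n (lv t)))))
    growing : ∀ i (s t : Fin (Periods n)) → suc (toℕ s) ≡ toℕ t → xLP i s Q.≤ xLP i t
    growing i s t e =
      QP.*-monoˡ-≤-nonNeg Q.½ (ι-≤ (below-mono (toℕ i) (stairs-mono n (count n) (consecutive-≤ e))))
    too-heavy : ∀ i t → ι (a ^ lv t) < weight i → xLP i t ≡ Q.0ℚ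
    too-heavy i t heavy = cong (λ b → Q.½ * ι b) (below-zero (ℕP.≰⇒> fits))
      where
      fits : toℕ i ℕ.≰ lv t
      fits i≤lv = QP.<-irrefl refl (QP.<-≤-trans heavy (ι-≤ (ℕP.^-monoʳ-≤ a i≤lv)))

  lp-value : objective inst xLP ≡ Q.½ * ι (sum lp-load)
  lp-value = trans (sumFin-cong (Periods n) lp-row) (sumFin-scaled (Periods n) Q.½ lp-load)

  -- Each period is at least filled by its own item, so the LP value is at least ½·n·P.
  lp-load-large : n ℕ.* P ℕ.≤ sum lp-load
  lp-load-large = ℕP.≤-trans (ℕP.≤-reflexive (sym (total-capacity (suc m)))) (sum-mono own-item)
    where
    own-item : ∀ t → a ^ lv t ℕ.≤ lp-load t
    own-item t = ℕP.≤-trans (ℕP.≤-reflexive (sym (trans (cong (ℕ._* a ^ lv t) (below-refl (lv t))) (ℕP.*-identityˡ _))))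
                            (sum-≥-term (lp-term t) (level n t))

  ip-value : ∀ y → IPFeasible inst y → Σ ℕ λ O → objective inst y ≡ ι O × O ℕ.≤ P ℕ.+ P
  ip-value y ((capacity , growing , too-heavy , _) , integral) = sum load , value , bound
    where
    β : Fin n → Fin (Periods n) → ℕ
    β i t = bit (integral i t)

    y≡β : ∀ i t → y i t ≡ ι (β i t)
    y≡β i t = bit-ι (integral i t)

    row : ∀ t → sumFin n (λ i → weight i * y i t) ≡ ι (sum (λ i → β i t ℕ.* a ^ toℕ i))
    row t = trans (sumFin-cong n (λ i → trans (cong (weight i *_) (y≡β i t))
                                              (trans (QP.*-comm (weight i) (ι (β i t))) (sym (ι-* (β i t) (a ^ toℕ i))))))
                  (sumFin-ι n (λ i → β i t ℕ.* a ^ toℕ i))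

    open Packing (suc m) β (λ i t → bit-binary (integral i t))
      (λ t → ι-≤⁻ (subst (Q._≤ ι (a ^ lv t)) (row t) (capacity t)))
      (λ i t lv<i → bit-zero (integral i t) (too-heavy i t (ι-< (ℕP.^-monoʳ-< a 2≤a lv<i))))
      (λ i → consecutive⇒monotone (β i)
               (λ s t e → ι-≤⁻ (subst₂ Q._≤_ (y≡β i s) (y≡β i t) (growing i s t e))))
      using (load; packing-bound)

    value : objective inst y ≡ ι (sum load)
    value = trans (sumFin-cong (Periods n) row) (sumFin-ι (Periods n) load)

    bound : sum load ℕ.≤ P ℕ.+ P
    bound = ℕP.*-cancelˡ-≤ a (ℕP.≤-trans packing-bound (ℕP.≤-reflexive scaled))
      where
      scaled : n ℕ.* (n ℕ.* P) ℕ.+ a ℕ.* P ≡ a ℕ.* (P ℕ.+ P)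
      scaled = trans (cong (ℕ._+ a ℕ.* P) (trans (sym (ℕP.*-assoc n n P)) (cong (ℕ._* P) (sym a≡n²))))
                     (sym (ℕP.*-distribˡ-+ a P P))

  lp-beats-ip : ∀ c → 4 ℕ.* c ≡ m → ∀ C → C Q.≤ ι c →
                (y : Assignment inst) → IPFeasible inst y → C * objective inst y < objective inst xLP
  lp-beats-ip c refl C C≤c y feasible =
    let O , value-y , O≤2P = ip-value y feasible in begin-strict
      C * objective inst y         ≡⟨ cong (C *_) value-y ⟩
      C * ι O                      ≤⟨ QP.*-monoʳ-≤-nonNeg (ι O) {{QP.normalize-nonNeg O 1}} C≤c ⟩
      ι c * ι O                    ≡⟨ trans (sym (ι-* c O)) (sym (half-double (c ℕ.* O))) ⟩
      Q.½ * ι (2 ℕ.* (c ℕ.* O))    <⟨ QP.*-monoʳ-<-pos Q.½ (ι-< (gap-arithmetic c P-positive O≤2P lp-load-large)) ⟩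
      Q.½ * ι (sum lp-load)        ≡⟨ sym lp-value ⟩
      objective inst xLP           ∎
    where open QP.≤-Reasoning

theorem1 : (C : ℚ) → Σ Instance (λ I → Σ (Assignment I) (λ x →
    LPFeasible I x × ((y : Assignment I) → IPFeasible I y → C * objective I y < objective I x)))
theorem1 C = inst , xLP , lp-feasible , lp-beats-ip c refl C (natAbove-≥ C)
  where
  c : ℕ
  c = natAbove C
  open Gap (4 ℕ.* c) _ refl
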